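{- Let $h:\Sigma_4^*\to\Sigma_4^*$ (with $\Sigma_4=\{0,1,2,3\}$) be the morphism $h(0)=0310201023$, $h(1)=0310230102$, $h(2)=0201031023$, $h(3)=0203010201$, and let $g:\Sigma_4^*\to\{0,1\}^*$ be the morphism $g(0)=010011$, $g(1)=010110$, $g(2)=011001$, $g(3)=011010$. Then the infinite binary word $g(h^\omega(0))$ is cubefree and contains no square $xx$ with $|x|\ge 4$.
   Context: Since $h(0)$ begins with $0$, $h^\omega(0)$ denotes the infinite fixed point $\lim_{n\to\infty}h^n(0)$ of $h$ starting with $0$. A square is a nonempty word $xx$, a cube a nonempty word $xxx$; cubefree means containing no cube as a subword. -}

module Defs where

open import Data.Nat using (ℕ; zero; suc; _+_; _*_; _<_; _≤_; _/_; _%_)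
open import Data.Fin using (Fin; zero; suc)
open import Data.List using (List; []; _∷_; concatMap)
open import Data.Maybe using (Maybe; just; nothing)
open import Data.Bool using (Bool; true; false)
open import Relation.Binary.PropositionalEquality using (_≡_)
open import Data.Empty using (⊥)

nth : {A : Set} → List A → ℕ → Maybe A
nth [] _ = nothing
nth (x ∷ xs) zero = just x
nth (x ∷ xs) (suc n) = nth xs n

Σ₄ : Set
Σ₄ = Fin 4

Σ₂ : Set
Σ₂ = Fin 2

s0 s1 s2 s3 : Σ₄
s0 = zero
s1 = suc zero
s2 = suc (suc zero)
s3 = suc (suc (suc zero))

b0 b1 : Σ₂
b0 = zero
b1 = suc zero

hL : Σ₄ → List Σ₄
hL zero = s0 ∷ s3 ∷ s1 ∷ s0 ∷ s2 ∷ s0 ∷ s1 ∷ s0 ∷ s2 ∷ s3 ∷ []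
hL (suc zero) = s0 ∷ s3 ∷ s1 ∷ s0 ∷ s2 ∷ s3 ∷ s0 ∷ s1 ∷ s0 ∷ s2 ∷ []
hL (suc (suc zero)) = s0 ∷ s2 ∷ s0 ∷ s1 ∷ s0 ∷ s3 ∷ s1 ∷ s0 ∷ s2 ∷ s3 ∷ []
hL (suc (suc (suc zero))) = s0 ∷ s2 ∷ s0 ∷ s3 ∷ s0 ∷ s1 ∷ s0 ∷ s2 ∷ s0 ∷ s1 ∷ []

h : List Σ₄ → List Σ₄
h = concatMap hL

hIter : ℕ → List Σ₄ → List Σ₄
hIter zero w = w
hIter (suc n) w = h (hIter n w)

gL : Σ₄ → List Σ₂
gL zero = b0 ∷ b1 ∷ b0 ∷ b0 ∷ b1 ∷ b1 ∷ []
gL (suc zero) = b0 ∷ b1 ∷ b0 ∷ b1 ∷ b1 ∷ b0 ∷ []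
gL (suc (suc zero)) = b0 ∷ b1 ∷ b1 ∷ b0 ∷ b0 ∷ b1 ∷ []
gL (suc (suc (suc zero))) = b0 ∷ b1 ∷ b1 ∷ b0 ∷ b1 ∷ b0 ∷ []

g : List Σ₄ → List Σ₂
g = concatMap gL

-- Infinite words are functions ℕ → A.
-- h^ω(0): since h(0) begins with 0, h^n(0) is a prefix of h^(n+1)(0),
-- and |h^(n+1)(0)| = 10^(n+1) > n, so the n-th letter of the limit is the
-- n-th letter of h^(n+1)(0).  (The fallback 'zero' is never used.)
hω : ℕ → Σ₄
hω n with nth (hIter (suc n) (s0 ∷ [])) n
... | just a = a
... | nothing = zero

-- g applied to an infinite word: since every g(a) has length 6,
-- position i of g(u) is position (i mod 6) of g(u(i div 6)).
gω : (ℕ → Σ₄) → ℕ → Σ₂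
gω u i with nth (gL (u (i / 6))) (i % 6)
... | just b = b
... | nothing = zero

SquareAt : {A : Set} → (ℕ → A) → ℕ → ℕ → Set
SquareAt w i p = ∀ j → j < p → w (i + j) ≡ w (i + p + j)

CubeAt : {A : Set} → (ℕ → A) → ℕ → ℕ → Set
CubeAt w i p = ∀ j → j < p + p → w (i + j) ≡ w (i + p + j)

Cubefree : {A : Set} → (ℕ → A) → Set
Cubefree w = ∀ i p → 1 ≤ p → CubeAt w i p → ⊥

NoSquaresOfPeriodAtLeast : {A : Set} → ℕ → (ℕ → A) → Set
NoSquaresOfPeriodAtLeast k w = ∀ i p → k ≤ p → SquareAt w i p → ⊥

{-# OPTIONS --safe #-}
module Submission where

-- Write w = h^ω(0) and u = g(w).  Both are images of w under a uniform morphism: w under h (block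
-- length 10), u under g (block length 6).  The factors of length 2 of w are closed under taking
-- windows of h-images, which determines the factors of length 3 and 4 of w; every short factor
-- of w or u is then a window of the image of one of these, so short squares and cubes are
-- excluded by a finite check.  Long factors (length 12 in w, 9 in u) occur at only one offset
-- modulo the block length, so a long square has period 10q (resp. 6q) and cutting it along the
-- blocks gives a square of period q in w, impossible by induction on the period.  The one
-- exception is a square of u cut at offset 4, where g(1), g(3) share a suffix and g(3), g(2) a
-- prefix: it only yields a factor 1 x 3 x 2 of w with |1x| = q, which is again excluded by a
-- finite check for small q and by synchronizing once more in w for large q.

open import Data.Empty using (⊥; ⊥-elim)
open import Data.Fin using (Fin; zero; suc)
import Data.Fin.Properties as Fin
open import Data.List using (List; []; _∷_; _++_; take; drop; length; concatMap; map; upTo)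
open import Data.List.Properties using (concatMap-++; ++-assoc; ++-identityʳ; length-++; ≡-dec)
open import Data.List.Membership.Propositional using (_∈_)
open import Data.List.Membership.Propositional.Properties using (∈-map⁺; ∈-concat⁺′; ∈-upTo⁺)
open import Data.List.Membership.DecPropositional (≡-dec (Fin._≟_ {4})) using (_∈?_)
open import Data.List.Relation.Unary.All using (All; all?; lookup)
open import Data.Maybe using (Maybe; just; nothing)
open import Data.Maybe.Properties using (just-injective)
import Data.Maybe.Properties as Maybe
open import Data.Nat
  using (ℕ; zero; suc; pred; _+_; _*_; _∸_; _≤_; _<_; _≟_; _≤?_; _<?_; z≤n; s≤s; z<s; s<s; _/_; _%_; NonZero; >-nonZero)
open import Data.Nat.Properties
open import Data.Nat.DivMod
  using (m≡m%n+[m/n]*n; m%n<n; m/n<m; +-distrib-/-∣ʳ; m<n⇒m/n≡0; m*n/n≡m; [m+kn]%n≡m%n; m<n⇒m%n≡m)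
open import Data.Nat.Divisibility using (_∣_; divides; ∣m+n∣m⇒∣n; n∣m*n)
open import Data.Nat.Induction using (<-rec)
open import Data.Nat.Tactic.RingSolver using (solve)
open import Data.Product using (_×_; _,_; proj₁; proj₂; ∃)
open import Data.Sum using (_⊎_; inj₁; inj₂; [_,_]′)
import Data.Sum as Sum
open import Function using (_∘_)
open import Relation.Binary.Definitions using (DecidableEquality)
open import Relation.Binary.PropositionalEquality
open import Relation.Nullary using (¬_; Dec; contradiction; yes; no)
open import Relation.Nullary.Decidable using (from-yes; ¬?; _×-dec_; _⊎-dec_; _→-dec_)

open import Defs

factor : {A : Set} → (ℕ → A) → ℕ → ℕ → List A
factor w i zero = []
factor w i (suc k) = w i ∷ factor w (suc i) k

-- SquareAt w i p is Match w i p p, and CubeAt w i p is Match w i p (p + p).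
Match : {A : Set} → (ℕ → A) → ℕ → ℕ → ℕ → Set
Match w i p len = ∀ j → j < len → w (i + j) ≡ w (i + p + j)

HasPeriod : {A : Set} → ℕ → List A → Set
HasPeriod p u = take (length u ∸ p) u ≡ drop p u

AllFactorsIn : {A : Set} → (ℕ → A) → ℕ → List (List A) → Set
AllFactorsIn w k S = ∀ i → factor w i k ∈ S

≤-by : ∀ {m n} o → m + o ≡ n → m ≤ n
≤-by {m} o refl = m≤m+n m o

module _ {A : Set} where

  nth-++ˡ : ∀ (xs ys : List A) {n a} → nth xs n ≡ just a → nth (xs ++ ys) n ≡ just a
  nth-++ˡ (x ∷ xs) ys {zero} e = e
  nth-++ˡ (x ∷ xs) ys {suc n} e = nth-++ˡ xs ys e

  nth-++ʳ : ∀ (xs ys : List A) k → nth (xs ++ ys) (length xs + k) ≡ nth ys k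
  nth-++ʳ [] ys k = refl
  nth-++ʳ (x ∷ xs) ys k = nth-++ʳ xs ys k

  nth-just⇒< : ∀ (xs : List A) {t x} → nth xs t ≡ just x → t < length xs
  nth-just⇒< (x ∷ xs) {zero} _ = z<s
  nth-just⇒< (x ∷ xs) {suc t} e = s<s (nth-just⇒< xs e)

  <⇒nth≢nothing : ∀ (xs : List A) {t} → t < length xs → nth xs t ≢ nothing
  <⇒nth≢nothing (x ∷ xs) {zero} _ ()
  <⇒nth≢nothing (x ∷ xs) {suc t} (s<s t<n) = <⇒nth≢nothing xs t<n

  length-factor : ∀ (w : ℕ → A) i k → length (factor w i k) ≡ k
  length-factor w i zero = refl
  length-factor w i (suc k) = cong suc (length-factor w (suc i) k)

  factor-cong : ∀ {w v : ℕ → A} i i' k → (∀ j → j < k → w (i + j) ≡ v (i' + j)) →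
                factor w i k ≡ factor v i' k
  factor-cong i i' zero eq = refl
  factor-cong {w} {v} i i' (suc k) eq = cong₂ _∷_ first (factor-cong (suc i) (suc i') k rest)
    where
    first : w i ≡ v i'
    first = subst₂ (λ a b → w a ≡ v b) (+-identityʳ i) (+-identityʳ i') (eq 0 z<s)
    rest : ∀ j → j < k → w (suc i + j) ≡ v (suc i' + j)
    rest j j<k = subst₂ (λ a b → w a ≡ v b) (+-suc i j) (+-suc i' j) (eq (suc j) (s<s j<k))

  take-factor : ∀ (w : ℕ → A) i {k n} → k ≤ n → take k (factor w i n) ≡ factor w i k
  take-factor w i {zero} _ = refl
  take-factor w i {suc k} {suc n} (s≤s k≤n) = cong (w i ∷_) (take-factor w (suc i) k≤n)

  drop-factor : ∀ (w : ℕ → A) i r n → drop r (factor w i n) ≡ factor w (i + r) (n ∸ r)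
  drop-factor w i zero n = cong (λ a → factor w a n) (sym (+-identityʳ i))
  drop-factor w i (suc r) zero = refl
  drop-factor w i (suc r) (suc n) =
    trans (drop-factor w (suc i) r n) (cong (λ a → factor w a (n ∸ r)) (sym (+-suc i r)))

  factor-++ : ∀ (w : ℕ → A) i a b → factor w i (a + b) ≡ factor w i a ++ factor w (i + a) b
  factor-++ w i zero b = cong (λ x → factor w x b) (sym (+-identityʳ i))
  factor-++ w i (suc a) b = cong (w i ∷_) (trans (factor-++ w (suc i) a b)
                              (cong (λ x → factor w (suc i) a ++ factor w x b) (sym (+-suc i a))))

  nth-factor : ∀ (w : ℕ → A) i {j k} → j < k → nth (factor w i k) j ≡ just (w (i + j))
  nth-factor w i {zero} {suc k} _ = cong (just ∘ w) (sym (+-identityʳ i))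
  nth-factor w i {suc j} {suc k} (s<s j<k) =
    trans (nth-factor w (suc i) j<k) (cong (just ∘ w) (sym (+-suc i j)))

  factor-by-nth : ∀ (w : ℕ → A) i xs → (∀ t {x} → nth xs t ≡ just x → w (i + t) ≡ x) →
                  factor w i (length xs) ≡ xs
  factor-by-nth w i [] _ = refl
  factor-by-nth w i (x ∷ xs) letters =
    cong₂ _∷_ (trans (cong w (sym (+-identityʳ i))) (letters 0 refl))
              (factor-by-nth w (suc i) xs (λ t e → trans (cong w (sym (+-suc i t))) (letters (suc t) e)))

  factor-match : ∀ {w : ℕ → A} {i p len} → Match w i p len →
                 ∀ {i' k} → i ≤ i' → i' + k ≤ i + len → factor w i' k ≡ factor w (i' + p) k
  factor-match {w} {i} {p} {len} M {k = k} lower upper with ≤⇒≤″ lower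
  ... | record { quotient = d ; equality = refl } = factor-cong (i + d) (i + d + p) k shifted
    where
    shifted : ∀ j → j < k → w (i + d + j) ≡ w (i + d + p + j)
    shifted j j<k = subst₂ (λ a b → w a ≡ w b) (sym (+-assoc i d j)) reorder
                      (M (d + j) (<-≤-trans (+-monoʳ-< d j<k)
                                   (+-cancelˡ-≤ i (d + k) len (subst (_≤ i + len) (+-assoc i d k) upper))))
      where
      reorder : i + p + (d + j) ≡ i + d + p + j
      reorder = solve (i ∷ p ∷ d ∷ j ∷ [])

  match⇒hasPeriod : ∀ {w : ℕ → A} {i p len} → Match w i p len → HasPeriod p (factor w i (p + len))
  match⇒hasPeriod {w} {i} {p} {len} M = begin
    take (length u ∸ p) u           ≡⟨ cong (λ n → take (n ∸ p) u) (length-factor w i (p + len)) ⟩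
    take (p + len ∸ p) u            ≡⟨ cong (λ n → take n u) (m+n∸m≡n p len) ⟩
    take len u                      ≡⟨ take-factor w i (m≤n+m len p) ⟩
    factor w i len                  ≡⟨ factor-match M ≤-refl ≤-refl ⟩
    factor w (i + p) len            ≡⟨ cong (factor w (i + p)) (sym (m+n∸m≡n p len)) ⟩
    factor w (i + p) (p + len ∸ p)  ≡⟨ sym (drop-factor w i p (p + len)) ⟩
    drop p u                        ∎
    where
    open ≡-Reasoning
    u = factor w i (p + len)

  cube⇒square : ∀ {w : ℕ → A} {i p} → CubeAt w i p → SquareAt w i p
  cube⇒square {p = p} cube j j<p = cube j (≤-trans j<p (m≤m+n p p))

  square-from-head : ∀ (w : ℕ → A) m q → Match w (suc m) q (pred q) → w m ≡ w (m + q) → SquareAt w m q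
  square-from-head w m q M e zero _ =
    subst₂ (λ a b → w a ≡ w b) (sym (+-identityʳ m)) (sym (+-identityʳ (m + q))) e
  square-from-head w m (suc q) M e (suc j) (s<s j<q) =
    subst₂ (λ a b → w a ≡ w b) (sym (+-suc m j)) (sym (+-suc (m + suc q) j)) (M j j<q)

  square-from-tail : ∀ (w : ℕ → A) m q → Match w (suc m) q (pred q) → w (m + q) ≡ w (m + q + q) →
                     SquareAt w (suc m) q
  square-from-tail w m (suc q) M e j j<1+q with m<1+n⇒m<n∨m≡n j<1+q
  ... | inj₁ j<q = M j j<q
  ... | inj₂ refl = subst₂ (λ a b → w a ≡ w b) (+-suc m j) (+-suc (m + suc j) j) e

-- Blocks of a uniform morphism

data InBlock (L : ℕ) : ℕ → Set where
  position : ∀ n t → t < L → InBlock L (n * L + t)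

inBlock : ∀ L .{{_ : NonZero L}} i → InBlock L i
inBlock L i = subst (InBlock L) (sym i≡) (position (i / L) (i % L) (m%n<n i L))
  where
  i≡ : i ≡ i / L * L + i % L
  i≡ = trans (m≡m%n+[m/n]*n i L) (+-comm (i % L) (i / L * L))

[n*d+t]/d≡n : ∀ n {d t} .{{_ : NonZero d}} → t < d → (n * d + t) / d ≡ n
[n*d+t]/d≡n n {d} {t} t<d = begin
  (n * d + t) / d      ≡⟨ cong (_/ d) (+-comm (n * d) t) ⟩
  (t + n * d) / d      ≡⟨ +-distrib-/-∣ʳ t (n∣m*n n) ⟩
  t / d + n * d / d    ≡⟨ cong₂ _+_ (m<n⇒m/n≡0 t<d) (m*n/n≡m n d) ⟩
  n                    ∎
  where open ≡-Reasoning

[n*d+t]%d≡t : ∀ n {d t} .{{_ : NonZero d}} → t < d → (n * d + t) % d ≡ t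
[n*d+t]%d≡t n {d} {t} t<d = trans (cong (_% d) (+-comm (n * d) t)) (trans ([m+kn]%n≡m%n t n d) (m<n⇒m%n≡m t<d))

m%d≡[m+n]%d⇒d∣n : ∀ d .{{_ : NonZero d}} m n → m % d ≡ (m + n) % d → d ∣ n
m%d≡[m+n]%d⇒d∣n d m n eq = ∣m+n∣m⇒∣n (subst (d ∣_) (sym quotients) (n∣m*n ((m + n) / d))) (n∣m*n (m / d))
  where
  open ≡-Reasoning
  quotients : m / d * d + n ≡ (m + n) / d * d
  quotients = +-cancelˡ-≡ (m % d) _ _ (begin
    m % d + (m / d * d + n)          ≡⟨ sym (+-assoc (m % d) _ n) ⟩
    m % d + m / d * d + n            ≡⟨ cong (_+ n) (sym (m≡m%n+[m/n]*n m d)) ⟩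
    m + n                            ≡⟨ m≡m%n+[m/n]*n (m + n) d ⟩
    (m + n) % d + (m + n) / d * d    ≡⟨ cong (_+ (m + n) / d * d) (sym eq) ⟩
    m % d + (m + n) / d * d          ∎)

nth-concatMap : ∀ {A B : Set} {σ : A → List B} {L} → (∀ X → length (σ X) ≡ L) →
                ∀ v {n X t x} → nth v n ≡ just X → nth (σ X) t ≡ just x →
                nth (concatMap σ v) (n * L + t) ≡ just x
nth-concatMap {σ = σ} uniform (Y ∷ v) {zero} refl e = nth-++ˡ (σ Y) _ e
nth-concatMap {σ = σ} {L} uniform (Y ∷ v) {suc n} {t = t} e₁ e₂ = begin
  nth (σ Y ++ rest) (L + n * L + t)               ≡⟨ cong (nth (σ Y ++ rest)) offset ⟩
  nth (σ Y ++ rest) (length (σ Y) + (n * L + t))  ≡⟨ nth-++ʳ (σ Y) rest (n * L + t) ⟩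
  nth rest (n * L + t)                            ≡⟨ nth-concatMap uniform v e₁ e₂ ⟩
  just _                                          ∎
  where
  open ≡-Reasoning
  rest = concatMap σ v
  offset : L + n * L + t ≡ length (σ Y) + (n * L + t)
  offset = trans (+-assoc L (n * L) t) (cong (_+ (n * L + t)) (sym (uniform Y)))

-- The factors of length k of σ(v), v ∈ S, that start inside the image of the first letter of v,
-- each tagged with its starting offset.
windows : {A B : Set} → (A → List B) → ℕ → ℕ → List (List A) → List (List B × ℕ)
windows σ L k = concatMap (λ v → map (λ r → take k (drop r (concatMap σ v)) , r) (upTo L))

windowWords : {A B : Set} → (A → List B) → ℕ → ℕ → List (List A) → List (List B)
windowWords σ L k S = map proj₁ (windows σ L k S)

∈-windows : ∀ {A B : Set} {σ : A → List B} {L k S v r} → v ∈ S → r < L →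
            (take k (drop r (concatMap σ v)) , r) ∈ windows σ L k S
∈-windows {σ = σ} {k = k} {v = v} v∈S r<L =
  ∈-concat⁺′ (∈-map⁺ (λ r → take k (drop r (concatMap σ v)) , r) (∈-upTo⁺ r<L)) (∈-map⁺ _ v∈S)

Synchronizing : {B : Set} → List (List B × ℕ) → Set
Synchronizing T = All (λ x → All (λ y → proj₁ x ≡ proj₁ y → proj₂ x ≡ proj₂ y) T) T

CutDetermines : {A B : Set} → (A → List B) → ℕ → Set
CutDetermines σ r = (∀ X Y → drop r (σ X) ≡ drop r (σ Y) → X ≡ Y)
                  ⊎ (∀ X Y → take r (σ X) ≡ take r (σ Y) → X ≡ Y)

cut⇒injective : ∀ {A B : Set} {σ : A → List B} {r} → CutDetermines σ r → ∀ {X Y} → σ X ≡ σ Y → X ≡ Y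
cut⇒injective {r = r} (inj₁ suffix) = suffix _ _ ∘ cong (drop r)
cut⇒injective {r = r} (inj₂ prefix) = prefix _ _ ∘ cong (take r)

module UniformImage {A B : Set} (σ : A → List B) (L : ℕ) .{{_ : NonZero L}}
                    (w : ℕ → A) (F : ℕ → B) (block : ∀ n → factor F (n * L) L ≡ σ (w n)) where

  letter-in-block : ∀ n {t} → t < L → nth (σ (w n)) t ≡ just (F (n * L + t))
  letter-in-block n t<L = subst (λ u → nth u _ ≡ _) (block n) (nth-factor F (n * L) t<L)

  image-factor : ∀ m k → concatMap σ (factor w m k) ≡ factor F (m * L) (k * L)
  image-factor m zero = refl
  image-factor m (suc k) = begin
    σ (w m) ++ concatMap σ (factor w (suc m) k)         ≡⟨ cong₂ _++_ (sym (block m)) (image-factor (suc m) k) ⟩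
    factor F (m * L) L ++ factor F (L + m * L) (k * L)  ≡⟨ cong (λ i → factor F (m * L) L ++ factor F i (k * L))
                                                              (+-comm L (m * L)) ⟩
    factor F (m * L) L ++ factor F (m * L + L) (k * L)  ≡⟨ sym (factor-++ F (m * L) L (k * L)) ⟩
    factor F (m * L) (L + k * L)                        ∎
    where open ≡-Reasoning

  module _ {k k' : ℕ} {S : List (List A)} (bound : pred L + k ≤ k' * L) where

    factor∈windows : ∀ i → factor w (i / L) k' ∈ S → (factor F i k , i % L) ∈ windows σ L k S
    factor∈windows i v∈S = subst (λ u → (u , r) ∈ windows σ L k S) (sym window) (∈-windows v∈S (m%n<n i L))
      where
      open ≡-Reasoning
      m = i / L
      r = i % L
      i≡ : i ≡ m * L + r
      i≡ = trans (m≡m%n+[m/n]*n i L) (+-comm r (m * L))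
      fits : k ≤ k' * L ∸ r
      fits = m+n≤o⇒m≤o∸n k (subst (_≤ k' * L) (+-comm r k) (≤-trans (+-monoˡ-≤ k (<⇒≤pred (m%n<n i L))) bound))
      window : factor F i k ≡ take k (drop r (concatMap σ (factor w m k')))
      window = begin
        factor F i k                                   ≡⟨ cong (λ j → factor F j k) i≡ ⟩
        factor F (m * L + r) k                         ≡⟨ sym (take-factor F _ fits) ⟩
        take k (factor F (m * L + r) (k' * L ∸ r))     ≡⟨ cong (take k) (sym (drop-factor F (m * L) r (k' * L))) ⟩
        take k (drop r (factor F (m * L) (k' * L)))    ≡⟨ cong (take k ∘ drop r) (sym (image-factor m k')) ⟩
        take k (drop r (concatMap σ (factor w m k')))  ∎

    factor∈windowWords : ∀ i → factor w (i / L) k' ∈ S → factor F i k ∈ windowWords σ L k S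
    factor∈windowWords i = ∈-map⁺ proj₁ ∘ factor∈windows i

    factors∈windowWords : AllFactorsIn w k' S → AllFactorsIn F k (windowWords σ L k S)
    factors∈windowWords factors i = factor∈windowWords i (factors (i / L))

    period-multiple : Synchronizing (windows σ L k S) → AllFactorsIn w k' S →
                      ∀ {i p len} → k ≤ len → Match F i p len → L ∣ p
    period-multiple sync factors {i} {p} k≤len M =
      m%d≡[m+n]%d⇒d∣n L i p (lookup (lookup sync (tagged i)) (tagged (i + p)) same)
      where
      tagged = λ j → factor∈windows j (factors (j / L))
      same : factor F i k ≡ factor F (i + p) k
      same = factor-cong i (i + p) k (λ j j<k → M j (<-≤-trans j<k k≤len))

  module _ {i q len : ℕ} (M : Match F i (q * L) len) where

    prefix-match : ∀ {n s} → s ≤ L → i ≤ n * L → n * L + s ≤ i + len →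
                   take s (σ (w n)) ≡ take s (σ (w (n + q)))
    prefix-match {n} {s} s≤L lower upper = begin
      take s (σ (w n))                    ≡⟨ cong (take s) (sym (block n)) ⟩
      take s (factor F (n * L) L)         ≡⟨ take-factor F _ s≤L ⟩
      factor F (n * L) s                  ≡⟨ factor-match M lower upper ⟩
      factor F (n * L + q * L) s          ≡⟨ cong (λ j → factor F j s) (sym (*-distribʳ-+ L n q)) ⟩
      factor F ((n + q) * L) s            ≡⟨ sym (take-factor F _ s≤L) ⟩
      take s (factor F ((n + q) * L) L)   ≡⟨ cong (take s) (block (n + q)) ⟩
      take s (σ (w (n + q)))              ∎
      where open ≡-Reasoning

    suffix-match : ∀ {n s} → s ≤ L → i ≤ n * L + s → n * L + L ≤ i + len →
                   drop s (σ (w n)) ≡ drop s (σ (w (n + q)))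
    suffix-match {n} {s} s≤L lower upper = begin
      drop s (σ (w n))                      ≡⟨ cong (drop s) (sym (block n)) ⟩
      drop s (factor F (n * L) L)           ≡⟨ drop-factor F (n * L) s L ⟩
      factor F (n * L + s) (L ∸ s)          ≡⟨ factor-match M lower (subst (_≤ i + len) (sym ends) upper) ⟩
      factor F (n * L + s + q * L) (L ∸ s)  ≡⟨ cong (λ j → factor F j (L ∸ s)) shift ⟩
      factor F ((n + q) * L + s) (L ∸ s)    ≡⟨ sym (drop-factor F ((n + q) * L) s L) ⟩
      drop s (factor F ((n + q) * L) L)     ≡⟨ cong (drop s) (block (n + q)) ⟩
      drop s (σ (w (n + q)))                ∎
      where
      open ≡-Reasoning
      ends : n * L + s + (L ∸ s) ≡ n * L + L
      ends = trans (+-assoc (n * L) s (L ∸ s)) (cong (n * L +_) (m+[n∸m]≡n s≤L))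
      shift : n * L + s + q * L ≡ (n + q) * L + s
      shift = solve (n ∷ L ∷ s ∷ q ∷ [])

    block-match : ∀ {n} → i ≤ n * L → n * L + L ≤ i + len → σ (w n) ≡ σ (w (n + q))
    block-match {n} lower = suffix-match z≤n (subst (i ≤_) (sym (+-identityʳ (n * L))) lower)

  module _ {m r q : ℕ} (q≥1 : 1 ≤ q) (r≤L : r ≤ L) (sq : SquareAt F (m * L + r) (q * L)) where

    private
      L≤q*L : L ≤ q * L
      L≤q*L = subst (_≤ q * L) (*-identityˡ L) (*-monoˡ-≤ L q≥1)

    square-head : drop r (σ (w m)) ≡ drop r (σ (w (m + q)))
    square-head = suffix-match {q = q} sq r≤L ≤-refl
                    (≤-trans (+-monoʳ-≤ (m * L) L≤q*L) (+-monoˡ-≤ (q * L) (m≤m+n (m * L) r)))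

    square-tail : take r (σ (w (m + q))) ≡ take r (σ (w (m + q + q)))
    square-tail = prefix-match {q = q} sq r≤L lower (≤-reflexive (solve (m ∷ L ∷ r ∷ q ∷ [])))
      where
      lower : m * L + r ≤ (m + q) * L
      lower = ≤-trans (+-monoʳ-≤ (m * L) (≤-trans r≤L L≤q*L)) (≤-reflexive (sym (*-distribʳ-+ L m q)))

    square-interior : (∀ {X Y} → σ X ≡ σ Y → X ≡ Y) → Match w (suc m) q (pred q)
    square-interior injective j j<q-1 =
      subst (λ a → w (suc m + j) ≡ w a) reorder (injective (block-match {q = q} sq lower upper))
      where
      open ≤-Reasoning
      j+2≤q : suc (suc j) ≤ q
      j+2≤q = ≤-trans (s≤s j<q-1) (≤-reflexive (suc-pred q {{>-nonZero q≥1}}))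
      reorder : suc m + j + q ≡ suc m + q + j
      reorder = solve (m ∷ j ∷ q ∷ [])
      lower : m * L + r ≤ (suc m + j) * L
      lower = begin
        m * L + r          ≤⟨ +-monoʳ-≤ (m * L) r≤L ⟩
        m * L + L          ≡⟨ +-comm (m * L) L ⟩
        suc m * L          ≤⟨ *-monoˡ-≤ L (m≤m+n (suc m) j) ⟩
        (suc m + j) * L    ∎
      upper : (suc m + j) * L + L ≤ m * L + r + q * L
      upper = begin
        (suc m + j) * L + L      ≡⟨ solve (m ∷ j ∷ L ∷ []) ⟩
        (m + suc (suc j)) * L    ≤⟨ *-monoˡ-≤ L (+-monoʳ-≤ m j+2≤q) ⟩
        (m + q) * L              ≡⟨ *-distribʳ-+ L m q ⟩
        m * L + q * L            ≤⟨ +-monoˡ-≤ (q * L) (m≤m+n (m * L) r) ⟩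
        m * L + r + q * L        ∎

  desubstitute-square : ∀ {r} → CutDetermines σ r → ∀ {m q} → 1 ≤ q → r ≤ L → SquareAt F (m * L + r) (q * L) →
                        SquareAt w m q ⊎ SquareAt w (suc m) q
  desubstitute-square {r} cut {m} {q} q≥1 r≤L sq =
    Sum.map (λ suffix → square-from-head w m q interior (suffix _ _ (square-head {m} {r} {q} q≥1 r≤L sq)))
            (λ prefix → square-from-tail w m q interior (prefix _ _ (square-tail {m} {r} {q} q≥1 r≤L sq)))
            cut
    where
    interior = square-interior {m} {r} {q} q≥1 r≤L sq (cut⇒injective cut)

length-hL : ∀ X → length (hL X) ≡ 10
length-hL zero = refl
length-hL (suc zero) = refl
length-hL (suc (suc zero)) = refl
length-hL (suc (suc (suc zero))) = refl

length-gL : ∀ X → length (gL X) ≡ 6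
length-gL zero = refl
length-gL (suc zero) = refl
length-gL (suc (suc zero)) = refl
length-gL (suc (suc (suc zero))) = refl

hIter₀ : ℕ → List Σ₄
hIter₀ k = hIter k (s0 ∷ [])

hIter₀-step : ∀ k → ∃ λ R → hIter₀ (suc k) ≡ hIter₀ k ++ R
hIter₀-step zero = _ , refl
hIter₀-step (suc k) with hIter₀-step k
... | R , e = h R , trans (cong h e) (concatMap-++ hL (hIter₀ k) R)

hIter₀-extends : ∀ {k k'} → k ≤ k' → ∃ λ R → hIter₀ k' ≡ hIter₀ k ++ R
hIter₀-extends {k} k≤k' with m≤n⇒m<n∨m≡n k≤k'
... | inj₂ refl = [] , sym (++-identityʳ (hIter₀ k))
hIter₀-extends {k} {suc k'} _ | inj₁ (s≤s k≤k') with hIter₀-extends k≤k' | hIter₀-step k'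
... | R , e | R' , e' = R ++ R' , trans e' (trans (cong (_++ R') e) (++-assoc (hIter₀ k) R R'))

nth-hIter₀-mono : ∀ {k k' n a} → k ≤ k' → nth (hIter₀ k) n ≡ just a → nth (hIter₀ k') n ≡ just a
nth-hIter₀-mono {k} k≤k' e with hIter₀-extends k≤k'
... | R , eq rewrite eq = nth-++ˡ (hIter₀ k) R e

k<length-hIter₀ : ∀ k → k < length (hIter₀ k)
k<length-hIter₀ zero = z<s
k<length-hIter₀ (suc k) =
  subst (suc k <_) (sym (length-h (hIter₀ k)))
    (≤-<-trans (k<length-hIter₀ k) (m<m*n ℓ 10 {{>-nonZero (≤-<-trans z≤n (k<length-hIter₀ k))}} (s≤s (s≤s z≤n))))
  where
  ℓ = length (hIter₀ k)
  length-h : ∀ v → length (h v) ≡ length v * 10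
  length-h [] = refl
  length-h (X ∷ v) = trans (length-++ (hL X)) (cong₂ _+_ (length-hL X) (length-h v))

hω-defined : ∀ n → nth (hIter₀ (suc n)) n ≡ just (hω n)
hω-defined n with nth (hIter (suc n) (s0 ∷ [])) n in eq
... | just a = refl
... | nothing = ⊥-elim (<⇒nth≢nothing (hIter₀ (suc n)) (<-trans (n<1+n n) (k<length-hIter₀ (suc n))) eq)

nth-hIter₀⇒hω : ∀ k {n a} → nth (hIter₀ k) n ≡ just a → hω n ≡ a
nth-hIter₀⇒hω k {n} e = just-injective (trans (sym (nth-hIter₀-mono (m≤n⊔m k (suc n)) (hω-defined n)))
                                              (nth-hIter₀-mono (m≤m⊔n k (suc n)) e))

hω-block : ∀ n → factor hω (n * 10) 10 ≡ hL (hω n)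
hω-block n = subst (λ k → factor hω (n * 10) k ≡ hL (hω n)) (length-hL (hω n))
               (factor-by-nth hω (n * 10) (hL (hω n))
                 (λ t e → nth-hIter₀⇒hω (suc (suc n)) (nth-concatMap length-hL (hIter₀ (suc n)) (hω-defined n) e)))

gω-letter : ∀ u i {x} → nth (gL (u (i / 6))) (i % 6) ≡ just x → gω u i ≡ x
gω-letter u i e with nth (gL (u (i / 6))) (i % 6)
... | just b = just-injective e

gω-block : ∀ u n → factor (gω u) (n * 6) 6 ≡ gL (u n)
gω-block u n = subst (λ k → factor (gω u) (n * 6) k ≡ gL (u n)) (length-gL (u n))
                 (factor-by-nth (gω u) (n * 6) (gL (u n)) letter)
  where
  letter : ∀ t {x} → nth (gL (u n)) t ≡ just x → gω u (n * 6 + t) ≡ x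
  letter t e = gω-letter u (n * 6 + t) (subst₂ (λ m r → nth (gL (u m)) r ≡ just _)
                 (sym ([n*d+t]/d≡n n t<6)) (sym ([n*d+t]%d≡t n t<6)) e)
    where
    t<6 : t < 6
    t<6 = subst (t <_) (length-gL (u n)) (nth-just⇒< (gL (u n)) e)

module H = UniformImage hL 10 hω hω hω-block
module G = UniformImage gL 6 hω (gω hω) (gω-block hω)

_≟*_ : ∀ {n} → DecidableEquality (List (Fin n))
_≟*_ = ≡-dec Fin._≟_

_≟ᵐ_ : DecidableEquality (Maybe Σ₄)
_≟ᵐ_ = Maybe.≡-dec Fin._≟_

hasPeriod? : ∀ {n} p (u : List (Fin n)) → Dec (HasPeriod p u)
hasPeriod? p u = take (length u ∸ p) u ≟* drop p u

synchronizing? : ∀ {n} (T : List (List (Fin n) × ℕ)) → Dec (Synchronizing T)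
synchronizing? T = all? (λ (u , r) → all? (λ (u' , r') → (u ≟* u') →-dec (r ≟ r')) T) T

cutDetermines? : ∀ {n} (σ : Σ₄ → List (Fin n)) r → Dec (CutDetermines σ r)
cutDetermines? σ r = determines (drop r) ⊎-dec determines (take r)
  where
  determines : (f : List _ → List _) → Dec (∀ X Y → f (σ X) ≡ f (σ Y) → X ≡ Y)
  determines f = Fin.all? λ X → Fin.all? λ Y → (f (σ X) ≟* f (σ Y)) →-dec (X Fin.≟ Y)

factors₂ : List (List Σ₄)
factors₂ =
    (s0 ∷ s1 ∷ [])
  ∷ (s0 ∷ s2 ∷ [])
  ∷ (s0 ∷ s3 ∷ [])
  ∷ (s1 ∷ s0 ∷ [])
  ∷ (s2 ∷ s0 ∷ [])
  ∷ (s2 ∷ s3 ∷ [])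
  ∷ (s3 ∷ s0 ∷ [])
  ∷ (s3 ∷ s1 ∷ [])
  ∷ []

factors₃ : List (List Σ₄)
factors₃ =
    (s0 ∷ s1 ∷ s0 ∷ [])
  ∷ (s0 ∷ s2 ∷ s0 ∷ [])
  ∷ (s0 ∷ s2 ∷ s3 ∷ [])
  ∷ (s0 ∷ s3 ∷ s0 ∷ [])
  ∷ (s0 ∷ s3 ∷ s1 ∷ [])
  ∷ (s1 ∷ s0 ∷ s2 ∷ [])
  ∷ (s1 ∷ s0 ∷ s3 ∷ [])
  ∷ (s2 ∷ s0 ∷ s1 ∷ [])
  ∷ (s2 ∷ s0 ∷ s3 ∷ [])
  ∷ (s2 ∷ s3 ∷ s0 ∷ [])
  ∷ (s3 ∷ s0 ∷ s1 ∷ [])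
  ∷ (s3 ∷ s0 ∷ s2 ∷ [])
  ∷ (s3 ∷ s0 ∷ s3 ∷ [])
  ∷ (s3 ∷ s1 ∷ s0 ∷ [])
  ∷ []

factors₄ : List (List Σ₄)
factors₄ =
    (s0 ∷ s1 ∷ s0 ∷ s2 ∷ [])
  ∷ (s0 ∷ s1 ∷ s0 ∷ s3 ∷ [])
  ∷ (s0 ∷ s2 ∷ s0 ∷ s1 ∷ [])
  ∷ (s0 ∷ s2 ∷ s0 ∷ s3 ∷ [])
  ∷ (s0 ∷ s2 ∷ s3 ∷ s0 ∷ [])
  ∷ (s0 ∷ s3 ∷ s0 ∷ s1 ∷ [])
  ∷ (s0 ∷ s3 ∷ s1 ∷ s0 ∷ [])
  ∷ (s1 ∷ s0 ∷ s2 ∷ s0 ∷ [])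
  ∷ (s1 ∷ s0 ∷ s2 ∷ s3 ∷ [])
  ∷ (s1 ∷ s0 ∷ s3 ∷ s1 ∷ [])
  ∷ (s2 ∷ s0 ∷ s1 ∷ s0 ∷ [])
  ∷ (s2 ∷ s0 ∷ s3 ∷ s0 ∷ [])
  ∷ (s2 ∷ s0 ∷ s3 ∷ s1 ∷ [])
  ∷ (s2 ∷ s3 ∷ s0 ∷ s1 ∷ [])
  ∷ (s2 ∷ s3 ∷ s0 ∷ s2 ∷ [])
  ∷ (s2 ∷ s3 ∷ s0 ∷ s3 ∷ [])
  ∷ (s3 ∷ s0 ∷ s1 ∷ s0 ∷ [])
  ∷ (s3 ∷ s0 ∷ s2 ∷ s0 ∷ [])
  ∷ (s3 ∷ s0 ∷ s3 ∷ s1 ∷ [])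
  ∷ (s3 ∷ s1 ∷ s0 ∷ s2 ∷ [])
  ∷ []

hω-factors₂ : AllFactorsIn hω 2 factors₂
hω-factors₂ = <-rec (λ i → factor hω i 2 ∈ factors₂) step
  where
  closed : All (_∈ factors₂) (windowWords hL 10 2 factors₂)
  closed = from-yes (all? (_∈? factors₂) (windowWords hL 10 2 factors₂))
  step : ∀ i → (∀ {i'} → i' < i → factor hω i' 2 ∈ factors₂) → factor hω i 2 ∈ factors₂
  step zero _ = from-yes (factor hω 0 2 ∈? factors₂)
  step i@(suc _) earlier =
    lookup closed (H.factor∈windowWords {k = 2} {k' = 2} {S = factors₂} (≤-by 9 refl) i
                    (earlier (m/n<m i 10 (s≤s (s≤s z≤n)))))

hω-factors₃ : AllFactorsIn hω 3 factors₃
hω-factors₃ i = lookup (from-yes (all? (_∈? factors₃) (windowWords hL 10 3 factors₂)))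
                  (H.factors∈windowWords {k = 3} {k' = 2} (≤-by 8 refl) hω-factors₂ i)

hω-factors₄ : AllFactorsIn hω 4 factors₄
hω-factors₄ i = lookup (from-yes (all? (_∈? factors₄) (windowWords hL 10 4 factors₂)))
                  (H.factors∈windowWords {k = 4} {k' = 2} (≤-by 7 refl) hω-factors₂ i)

hω-short-factors : ∀ {k} → 9 + k ≤ 40 → AllFactorsIn hω k (windowWords hL 10 k factors₄)
hω-short-factors {k} bound = H.factors∈windowWords {k = k} {k' = 4} {S = factors₄} bound hω-factors₄

gω-short-factors : ∀ {k} → 5 + k ≤ 24 → AllFactorsIn (gω hω) k (windowWords gL 6 k factors₄)
gω-short-factors {k} bound = G.factors∈windowWords {k = k} {k' = 4} {S = factors₄} bound hω-factors₄

hω-period-multiple : ∀ i p {len} → 12 ≤ len → Match hω i p len → 10 ∣ p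
hω-period-multiple i p = H.period-multiple {k = 12} {k' = 3} {S = factors₃} (≤-by 9 refl)
                           (from-yes (synchronizing? (windows hL 10 12 factors₃))) hω-factors₃ {i} {p}

gω-period-multiple : ∀ i p {len} → 9 ≤ len → Match (gω hω) i p len → 6 ∣ p
gω-period-multiple i p = G.period-multiple {k = 9} {k' = 3} {S = factors₃} (≤-by 4 refl)
                           (from-yes (synchronizing? (windows gL 6 9 factors₃))) hω-factors₃ {i} {p}

-- Squares of h^ω(0)

hω-short-squares : ∀ {q} → q < 12 → 1 ≤ q → All (¬_ ∘ HasPeriod q) (windowWords hL 10 (q + q) factors₄)
hω-short-squares = from-yes (allUpTo? (λ q → 1 ≤? q →-dec
                     all? (¬? ∘ hasPeriod? q) (windowWords hL 10 (q + q) factors₄)) 12)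

hL-cuts : ∀ {r} → r < 10 → CutDetermines hL r
hL-cuts = from-yes (allUpTo? (cutDetermines? hL) 10)

hω-desubstitute : ∀ {i q} → InBlock 10 i → 1 ≤ q → SquareAt hω i (q * 10) → ∃ λ i' → SquareAt hω i' q
hω-desubstitute {q = q} (position m r r<10) q≥1 sq =
  [ (m ,_) , (suc m ,_) ]′ (H.desubstitute-square (hL-cuts r<10) {m} {q} q≥1 (<⇒≤ r<10) sq)

hω-squarefree : NoSquaresOfPeriodAtLeast 1 hω
hω-squarefree i q = <-rec (λ q → ∀ i → 1 ≤ q → ¬ SquareAt hω i q) step q i
  where
  step : ∀ q → (∀ {q'} → q' < q → ∀ i → 1 ≤ q' → ¬ SquareAt hω i q') → ∀ i → 1 ≤ q → ¬ SquareAt hω i q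
  step q shorter i q≥1 sq with q <? 12
  ... | yes q<12 = lookup (hω-short-squares q<12 q≥1) (hω-short-factors bound i) (match⇒hasPeriod sq)
    where
    q≤11 = ≤-pred q<12
    bound : 9 + (q + q) ≤ 40
    bound = ≤-trans (+-monoʳ-≤ 9 (+-mono-≤ q≤11 q≤11)) (≤-by 9 refl)
  ... | no q≮12 = long (hω-period-multiple i q (≮⇒≥ q≮12) sq)
    where
    long : 10 ∣ q → ⊥
    long (divides zero q≡0) = contradiction (subst (1 ≤_) q≡0 q≥1) λ ()
    long (divides q'@(suc _) q≡q'*10) =
      let i' , sq' = hω-desubstitute (inBlock 10 i) z<s (subst (SquareAt hω i) q≡q'*10 sq)
      in shorter (subst (q' <_) (sym q≡q'*10) (m<m*n q' 10 (s≤s (s≤s z≤n)))) i' z<s sq'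

-- The factors 1 x 3 x 2 of h^ω(0)

Pattern : (ℕ → Σ₄) → ℕ → ℕ → Set
Pattern w m q = w m ≡ s1 × w (m + q) ≡ s3 × w (m + q + q) ≡ s2 × Match w (suc m) q (pred q)

IsPattern : ℕ → List Σ₄ → Set
IsPattern q u = nth u 0 ≡ just s1 × nth u q ≡ just s3 × nth u (q + q) ≡ just s2
              × take (pred q) (drop 1 u) ≡ take (pred q) (drop (suc q) u)

isPattern? : ∀ q u → Dec (IsPattern q u)
isPattern? q u = (nth u 0 ≟ᵐ just s1) ×-dec (nth u q ≟ᵐ just s3) ×-dec (nth u (q + q) ≟ᵐ just s2)
                 ×-dec (take (pred q) (drop 1 u) ≟* take (pred q) (drop (suc q) u))

pattern⇒isPattern : ∀ {w : ℕ → Σ₄} {m q} → Pattern w m q → IsPattern q (factor w m (suc (q + q)))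
pattern⇒isPattern {w} {m} {q} (e₁ , e₂ , e₃ , M) =
  trans (nth-factor w m {k = suc (q + q)} z<s) (cong just (trans (cong w (+-identityʳ m)) e₁)) ,
  trans (nth-factor w m (s≤s (m≤m+n q q))) (cong just e₂) ,
  trans (nth-factor w m (n<1+n (q + q))) (cong just (trans (cong w (sym (+-assoc m q q))) e₃)) ,
  interior
  where
  open ≡-Reasoning
  q-1≤q : pred q ≤ q + q ∸ q
  q-1≤q = subst (pred q ≤_) (sym (m+n∸m≡n q q)) pred[n]≤n
  interior : take (pred q) (factor w (suc m) (q + q)) ≡ take (pred q) (drop q (factor w (suc m) (q + q)))
  interior = begin
    take (pred q) (factor w (suc m) (q + q))           ≡⟨ take-factor w (suc m) (≤-trans pred[n]≤n (m≤m+n q q)) ⟩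
    factor w (suc m) (pred q)                          ≡⟨ factor-cong (suc m) (suc m + q) (pred q) M ⟩
    factor w (suc m + q) (pred q)                      ≡⟨ sym (take-factor w (suc m + q) q-1≤q) ⟩
    take (pred q) (factor w (suc m + q) (q + q ∸ q))   ≡⟨ cong (take (pred q)) (sym (drop-factor w (suc m) q (q + q))) ⟩
    take (pred q) (drop q (factor w (suc m) (q + q)))  ∎

hω-short-patterns : ∀ {q} → q < 13 → All (¬_ ∘ IsPattern q) (windowWords hL 10 (suc (q + q)) factors₄)
hω-short-patterns =
  from-yes (allUpTo? (λ q → all? (¬? ∘ isPattern? q) (windowWords hL 10 (suc (q + q)) factors₄)) 13)

-- What a pattern of period 10q at offset ρ in a block says about the three blocks h(X), h(Y), h(Z) it visits.
BlockPattern : ℕ → Σ₄ → Σ₄ → Σ₄ → Set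
BlockPattern ρ X Y Z = nth (hL X) ρ ≡ just s1 × nth (hL Y) ρ ≡ just s3 × nth (hL Z) ρ ≡ just s2
                     × drop (suc ρ) (hL X) ≡ drop (suc ρ) (hL Y) × take ρ (hL Y) ≡ take ρ (hL Z)

hL-no-blockPattern : ∀ {ρ} → ρ < 10 → ∀ X Y Z → ¬ BlockPattern ρ X Y Z
hL-no-blockPattern =
  from-yes (allUpTo? (λ ρ → Fin.all? λ X → Fin.all? λ Y → Fin.all? λ Z → ¬? (blockPattern? ρ X Y Z)) 10)
  where
  blockPattern? : ∀ ρ X Y Z → Dec (BlockPattern ρ X Y Z)
  blockPattern? ρ X Y Z = (nth (hL X) ρ ≟ᵐ just s1) ×-dec (nth (hL Y) ρ ≟ᵐ just s3) ×-dec (nth (hL Z) ρ ≟ᵐ just s2)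
                          ×-dec (drop (suc ρ) (hL X) ≟* drop (suc ρ) (hL Y)) ×-dec (take ρ (hL Y) ≟* take ρ (hL Z))

hω-long-pattern : ∀ {m q₀} → InBlock 10 m → ¬ Pattern hω m (suc q₀ * 10)
hω-long-pattern {q₀ = q₀} (position m ρ ρ<10) (e₁ , e₂ , e₃ , M) =
  hL-no-blockPattern ρ<10 (hω m) (hω (m + q)) (hω (m + q + q))
    ( trans (H.letter-in-block m ρ<10) (cong just e₁)
    , trans (H.letter-in-block (m + q) ρ<10) (cong just (trans (cong hω second) e₂))
    , trans (H.letter-in-block (m + q + q) ρ<10) (cong just (trans (cong hω third) e₃))
    , H.suffix-match {q = q} M {n = m} ρ<10 (≤-reflexive (sym (+-suc (m * 10) ρ))) (≤-by (ρ + q₀ * 10) after)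
    , H.prefix-match {q = q} M {n = m + q} (<⇒≤ ρ<10) before (≤-reflexive last) )
  where
  q = suc q₀
  second : (m + suc q₀) * 10 + ρ ≡ m * 10 + ρ + suc q₀ * 10
  second = solve (m ∷ q₀ ∷ ρ ∷ [])
  third : (m + suc q₀ + suc q₀) * 10 + ρ ≡ m * 10 + ρ + suc q₀ * 10 + suc q₀ * 10
  third = solve (m ∷ q₀ ∷ ρ ∷ [])
  after : m * 10 + 10 + (ρ + q₀ * 10) ≡ suc (m * 10 + ρ) + (9 + q₀ * 10)
  after = solve (m ∷ ρ ∷ q₀ ∷ [])
  last : (m + suc q₀) * 10 + ρ ≡ suc (m * 10 + ρ) + (9 + q₀ * 10)
  last = solve (m ∷ q₀ ∷ ρ ∷ [])
  blocks : m * 10 + 10 + q₀ * 10 ≡ (m + suc q₀) * 10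
  blocks = solve (m ∷ q₀ ∷ [])
  before : suc (m * 10 + ρ) ≤ (m + q) * 10
  before = ≤-trans (≤-reflexive (sym (+-suc (m * 10) ρ))) (≤-trans (+-monoʳ-≤ (m * 10) ρ<10) (≤-by (q₀ * 10) blocks))

hω-pattern-free : ∀ m q → ¬ Pattern hω m q
hω-pattern-free m q pat with q <? 13
... | yes q<13 = lookup (hω-short-patterns q<13) (hω-short-factors bound m) (pattern⇒isPattern pat)
  where
  q≤12 = ≤-pred q<13
  bound : 9 + suc (q + q) ≤ 40
  bound = ≤-trans (+-monoʳ-≤ 10 (+-mono-≤ q≤12 q≤12)) (≤-by 6 refl)
... | no q≮13 = long (hω-period-multiple (suc m) q (pred-mono-≤ (≮⇒≥ q≮13)) interior)
  where
  interior = proj₂ (proj₂ (proj₂ pat))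
  long : 10 ∣ q → ⊥
  long (divides zero q≡0) = q≮13 (subst (_< 13) (sym q≡0) z<s)
  long (divides (suc q₀) q≡) = hω-long-pattern {q₀ = q₀} (inBlock 10 m) (subst (Pattern hω m) q≡ pat)

-- Squares and cubes of g(h^ω(0))

gω-short-squares : ∀ {p} → p < 9 → 4 ≤ p → All (¬_ ∘ HasPeriod p) (windowWords gL 6 (p + p) factors₄)
gω-short-squares = from-yes (allUpTo? (λ p → 4 ≤? p →-dec
                     all? (¬? ∘ hasPeriod? p) (windowWords gL 6 (p + p) factors₄)) 9)

gω-short-cubes : ∀ {p} → p < 4 → 1 ≤ p → All (¬_ ∘ HasPeriod p) (windowWords gL 6 (p + (p + p)) factors₄)
gω-short-cubes = from-yes (allUpTo? (λ p → 1 ≤? p →-dec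
                   all? (¬? ∘ hasPeriod? p) (windowWords gL 6 (p + (p + p)) factors₄)) 4)

gL-cuts : ∀ {r} → r < 6 → r ≢ 4 → CutDetermines gL r
gL-cuts = from-yes (allUpTo? (λ r → ¬? (r ≟ 4) →-dec cutDetermines? gL r) 6)

-- g(1) and g(3) share their suffix of length 2, g(3) and g(2) their prefix of length 4.
gL-cut-at-4 : ∀ X Y Z → drop 4 (gL X) ≡ drop 4 (gL Y) → take 4 (gL Y) ≡ take 4 (gL Z) →
              X ≡ Y ⊎ Y ≡ Z ⊎ (X ≡ s1 × Y ≡ s3 × Z ≡ s2)
gL-cut-at-4 = from-yes (Fin.all? λ X → Fin.all? λ Y → Fin.all? λ Z →
                (drop 4 (gL X) ≟* drop 4 (gL Y)) →-dec (take 4 (gL Y) ≟* take 4 (gL Z)) →-dec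
                ((X Fin.≟ Y) ⊎-dec (Y Fin.≟ Z) ⊎-dec (X Fin.≟ s1) ×-dec (Y Fin.≟ s3) ×-dec (Z Fin.≟ s2)))

gω-desubstitute-at-4 : ∀ {m q} → 1 ≤ q → SquareAt (gω hω) (m * 6 + 4) (q * 6) →
                       SquareAt hω m q ⊎ SquareAt hω (suc m) q ⊎ Pattern hω m q
gω-desubstitute-at-4 {m} {q} q≥1 sq =
  Sum.map (square-from-head hω m q interior)
          (Sum.map (square-from-tail hω m q interior) (λ (x , y , z) → x , y , z , interior))
          (gL-cut-at-4 (hω m) (hω (m + q)) (hω (m + q + q))
            (G.square-head {m} {4} {q} q≥1 4≤6 sq) (G.square-tail {m} {4} {q} q≥1 4≤6 sq))
  where
  4≤6 : 4 ≤ 6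
  4≤6 = ≤-by 2 refl
  interior : Match hω (suc m) q (pred q)
  interior = G.square-interior {m} {4} {q} q≥1 4≤6 sq (cut⇒injective {r = 0} (gL-cuts z<s λ ()))

gω-no-block-square : ∀ {i q} → InBlock 6 i → 1 ≤ q → ¬ SquareAt (gω hω) i (q * 6)
gω-no-block-square {q = q} (position m r r<6) q≥1 sq with r ≟ 4
... | no r≢4 = [ hω-squarefree m q q≥1 , hω-squarefree (suc m) q q≥1 ]′
                 (G.desubstitute-square (gL-cuts r<6 r≢4) {m} {q} q≥1 (<⇒≤ r<6) sq)
... | yes refl = [ hω-squarefree m q q≥1 , [ hω-squarefree (suc m) q q≥1 , hω-pattern-free m q ]′ ]′
                   (gω-desubstitute-at-4 {m} {q} q≥1 sq)

gω-long-squares-free : NoSquaresOfPeriodAtLeast 4 (gω hω)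
gω-long-squares-free i p p≥4 sq with p <? 9
... | yes p<9 = lookup (gω-short-squares p<9 p≥4) (gω-short-factors bound i) (match⇒hasPeriod sq)
  where
  p≤8 = ≤-pred p<9
  bound : 5 + (p + p) ≤ 24
  bound = ≤-trans (+-monoʳ-≤ 5 (+-mono-≤ p≤8 p≤8)) (≤-by 3 refl)
... | no p≮9 = long (gω-period-multiple i p (≮⇒≥ p≮9) sq)
  where
  long : 6 ∣ p → ⊥
  long (divides zero p≡0) = contradiction (subst (4 ≤_) p≡0 p≥4) λ ()
  long (divides q@(suc _) p≡q*6) = gω-no-block-square {q = q} (inBlock 6 i) z<s (subst (SquareAt (gω hω) i) p≡q*6 sq)

gω-cubefree : Cubefree (gω hω)
gω-cubefree i p p≥1 cube with p <? 4
... | yes p<4 = lookup (gω-short-cubes p<4 p≥1) (gω-short-factors bound i) (match⇒hasPeriod cube)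
  where
  p≤3 = ≤-pred p<4
  bound : 5 + (p + (p + p)) ≤ 24
  bound = ≤-trans (+-monoʳ-≤ 5 (+-mono-≤ p≤3 (+-mono-≤ p≤3 p≤3))) (≤-by 10 refl)
... | no p≮4 = gω-long-squares-free i p (≮⇒≥ p≮4) (cube⇒square {w = gω hω} {i} {p} cube)

corollary6 : Cubefree (gω hω) × NoSquaresOfPeriodAtLeast 4 (gω hω)
corollary6 = gω-cubefree , gω-long-squares-free
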